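{- Let $L$ be an $h$-sorted lattice data structure with $N$ proper keys. If the procedure $P$ performing each jump step of JumpSearchLDS runs in time $O(\log m)$ on $m$ elements, then JumpSearchLDS on $L$ runs in time $O(\log N)$.
   Context: Diagram of height $h$: cells $(r,c)$ of positive integers with $r+c\le h+4$; $r$ is the row (numbered bottom to top), $c$ the column (left to right). Diagonal $k$ ($1\le k\le h+3$) is the set of cells with $r+c=k+1$, numbered from head $(k,1)$ to tail $(1,k)$, its $j$-th cell being $(k+1-j,j)$. A lattice data structure (LDS) of height $h$ assigns to each cell an entry in $\{0,\infty\}\cup\mathbb{Z}_{>0}$ such that: (1) all cells of row $1$ and column $1$ contain $0$; (2) all cells of diagonal $h+3$ except head and tail contain $\infty$; (3) for some $0\le m\le h-1$, exactly the cells $(h+3-j,j)$ of diagonal $h+2$ with $h+2-m\le j\le h+1$ contain $\infty$; (4) all remaining cells contain pairwise distinct positive integers (proper keys); (5) proper keys are strictly increasing along each row (left to right), column (bottom to top) and diagonal (head to tail). Order convention: $0<n<\infty$. $L$ (with $h\ge3$) is $h$-sorted if for every $s$ with $4\le s\le h+2$, the first proper key of diagonal $s$ (counting from the head) is greater than the last proper key of diagonal $s-1$. JumpSearchLDS($L,K$) for a positive integer $K$: start at $C=(h+1,2)$; while the entry of $C$ is neither $K$ nor $0$: if $K<C$, move $C$ down its column to the first cell (going downward) with entry $\le K$; otherwise move $C$ along its diagonal toward the tail to the first cell with entry $\ge K$, or to a cell with entry $0$ if there is none. Report present iff the final entry is $K$. Each jump is carried out by a procedure $P$ applied to the relevant sorted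 part of the current column or diagonal. -}

module Defs where

open import Data.Nat using (ℕ; zero; suc; _+_; _*_; _∸_; _≤_; _<_; _≤ᵇ_; _<ᵇ_; _≡ᵇ_)
open import Data.Bool using (Bool; true; false; if_then_else_)
open import Data.Product using (Σ; _×_; _,_; proj₁; proj₂; ∃-syntax)
open import Relation.Binary.PropositionalEquality using (_≡_)
open import Relation.Nullary using (¬_)

-- Entries of an LDS: 0, ∞, or a (natural-number) key.
-- The order convention 0 < n < ∞ is only used through the boolean
-- comparisons with a search key below.

data Entry : Set where
  zer : Entry
  ∞   : Entry
  key : ℕ → Entry

IsKey : Entry → Set
IsKey e = Σ ℕ λ n → 0 < n × e ≡ key n

KeyLess : Entry → Entry → Set
KeyLess e e' = ∀ n n' → e ≡ key n → e' ≡ key n' → n < n'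

-- An assignment of entries to cells (r , c) (row r, column c);
-- only the values on the diagram matter.
Assignment : Set
Assignment = ℕ → ℕ → Entry

InDiagram : ℕ → ℕ → ℕ → Set
InDiagram h r c = 1 ≤ r × 1 ≤ c × r + c ≤ h + 4

-- Lattice data structure of height h.
-- Diagonal k consists of the cells with r + c = k + 1; its j-th cell is
-- (k + 1 - j , j).

record IsLDS (h : ℕ) (L : Assignment) : Set where
  field
    row1 : ∀ c → 1 ≤ c → c ≤ h + 3 → L 1 c ≡ zer
    col1 : ∀ r → 1 ≤ r → r ≤ h + 3 → L r 1 ≡ zer
    diagTop : ∀ j → 2 ≤ j → j ≤ h + 2 → L (h + 4 ∸ j) j ≡ ∞
    m     : ℕ
    m<h   : m + 1 ≤ h
    diag2-inf : ∀ j → h + 2 ∸ m ≤ j → j ≤ h + 1 → L (h + 3 ∸ j) j ≡ ∞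
    diag2-key : ∀ j → 2 ≤ j → j < h + 2 ∸ m → IsKey (L (h + 3 ∸ j) j)
    inner-key : ∀ r c → 2 ≤ r → 2 ≤ c → r + c ≤ h + 2 → IsKey (L r c)
    distinct : ∀ r c r' c' n → InDiagram h r c → InDiagram h r' c' →
               L r c ≡ key n → L r' c' ≡ key n → r ≡ r' × c ≡ c'
    incRow  : ∀ r c c' → InDiagram h r c → InDiagram h r c' → c < c' →
              KeyLess (L r c) (L r c')
    incCol  : ∀ r r' c → InDiagram h r c → InDiagram h r' c → r < r' →
              KeyLess (L r c) (L r' c)
    incDiag : ∀ r c r' c' → InDiagram h r c → InDiagram h r' c' →
              r + c ≡ r' + c' → c < c' → KeyLess (L r c) (L r' c')

diagEntry : Assignment → ℕ → ℕ → Entry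
diagEntry L s j = L (s + 1 ∸ j) j

FirstProper : Assignment → ℕ → ℕ → Set
FirstProper L s j = 1 ≤ j × j ≤ s × IsKey (diagEntry L s j) ×
                    (∀ i → 1 ≤ i → i < j → ¬ IsKey (diagEntry L s i))

LastProper : Assignment → ℕ → ℕ → Set
LastProper L s j = 1 ≤ j × j ≤ s × IsKey (diagEntry L s j) ×
                   (∀ i → j < i → i ≤ s → ¬ IsKey (diagEntry L s i))

record HSorted (h : ℕ) (L : Assignment) : Set where
  field
    h≥3 : 3 ≤ h
    lds : IsLDS h L
    sorted : ∀ s → 4 ≤ s → s ≤ h + 2 → ∀ j j' →
             FirstProper L s j → LastProper L (s ∸ 1) j' →
             KeyLess (diagEntry L (s ∸ 1) j') (diagEntry L s j)

-- Number of proper keys (= number of cells of the diagram holding a key;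
-- in an LDS key entries are exactly the proper keys).

isKeyᵇ : Entry → ℕ
isKeyᵇ (key _) = 1
isKeyᵇ _       = 0

rowCount : Assignment → ℕ → ℕ → ℕ
rowCount L r zero    = 0
rowCount L r (suc n) = isKeyᵇ (L r (suc n)) + rowCount L r n

rowsCount : ℕ → Assignment → ℕ → ℕ
rowsCount h L zero    = 0
rowsCount h L (suc k) = rowCount L (suc k) (h + 4 ∸ suc k) + rowsCount h L k

numKeys : ℕ → Assignment → ℕ
numKeys h L = rowsCount h L (h + 3)

-- Each iteration of the while loop costs 1; each jump from a cell in row r
-- additionally costs T r, the running time of procedure P on the sorted
-- part of the current column / diagonal starting at the current cell,
-- which has r elements (cells from C down to row 1, resp. from C to the
-- tail of its diagonal).

data Action : Set where
  stop down diag : Action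

action : ℕ → Entry → Action
action K zer     = stop
action K ∞       = down
action K (key n) = if n ≡ᵇ K then stop else (if K <ᵇ n then down else diag)

leK : ℕ → Entry → Bool
leK K zer     = true
leK K ∞       = false
leK K (key n) = n ≤ᵇ K

geK-or-0 : ℕ → Entry → Bool
geK-or-0 K zer     = true
geK-or-0 K ∞       = true
geK-or-0 K (key n) = K ≤ᵇ n

colDown : Assignment → ℕ → ℕ → ℕ → ℕ
colDown L K c zero    = zero    -- unreachable for an LDS (row 1 holds 0)
colDown L K c (suc k) = if leK K (L (suc k) c) then suc k else colDown L K c k

diagScan : Assignment → ℕ → ℕ → ℕ → ℕ × ℕ
diagScan L K zero    c = (zero , c)   -- unreachable for an LDS
diagScan L K (suc k) c =
  if geK-or-0 K (L (suc k) c) then (suc k , c) else diagScan L K k (suc c)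

runCost : (ℕ → ℕ) → Assignment → ℕ → ℕ → ℕ → ℕ → ℕ
runCost T L K zero     r c = 0
runCost T L K (suc f) r c with action K (L r c)
... | stop = 1
... | down = 1 + T r + runCost T L K f (colDown L K c (r ∸ 1)) c
... | diag = 1 + T r + runCost T L K f (proj₁ p) (proj₂ p)
  where p = diagScan L K (r ∸ 1) (suc c)

-- JumpSearchLDS starts at (h+1 , 2). Every jump strictly decreases the row,
-- so on an LDS the loop ends after at most h+1 iterations; fuel h+2 suffices.
jumpSearchCost : (ℕ → ℕ) → ℕ → Assignment → ℕ → ℕ
jumpSearchCost T h L K = runCost T L K (h + 2) (h + 1) 2

module Submission where

-- Let U bound the cost 1 + T r of a single iteration of the
-- loop from any row r ≤ h + 1.  On an h-sorted LDS the search ends after at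
-- most five iterations, so its cost is at most 5 · U; since U = O(log h) and
-- the diagram has at least h - 1 keys (those of row 2), this is O(log N).
--
-- The five-iteration bound follows the loop through its possible phases:
--   * tail phase: on an anti-diagonal all of whose keys are below K, one
--     diagonal jump reaches the 0 at its tail (≤ 2 iterations);
--   * descent phase: jumping down from a cell whose lower anti-diagonal is
--     below K lands one row lower, in a tail phase (≤ 3);
--   * landing phase: after a diagonal jump the search stops or descends (≤ 3);
--   * column 2: a key y < K at (r , 2) dominates the whole previous
--     anti-diagonal (this is where h-sortedness enters), so the diagonal jump
--     from there ends in a landing phase (≤ 4);
--   * the start (h + 1 , 2) either jumps along its diagonal or descends
--     column 2 first (≤ 5).

open import Data.Bool using (T; true; false)
open import Data.Empty using (⊥-elim)
open import Data.Nat
open import Data.Nat.Properties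
open import Data.Nat.Logarithm using (⌊log₂_⌋; ⌊log₂⌋-mono-≤; ⌊log₂[2*b]⌋≡1+⌊log₂b⌋)
open import Data.Nat.Tactic.RingSolver using (solve-∀)
open import Data.Product using (_×_; _,_; proj₁; proj₂; ∃-syntax)
open import Data.Sum using (inj₁; inj₂)
open import Data.Unit using (tt)
open import Function using (_∘_)
open import Relation.Binary.Definitions using (tri<; tri≈; tri>)
open import Relation.Binary.PropositionalEquality
open import Relation.Nullary using (¬_; contradiction)

open import Defs

column-after : ∀ {a b k c} → a ≤ k → a + b ≡ k + c → c ≤ b
column-after {a} {b} {k} {c} a≤k eq =
  +-cancelˡ-≤ k c b (≤-trans (≤-reflexive (sym eq)) (+-monoˡ-≤ b a≤k))

column-before : ∀ {a b k c} → k ≤ a → a + b ≡ k + c → b ≤ c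
column-before {a} {b} {k} {c} k≤a eq =
  +-cancelˡ-≤ k b c (≤-trans (+-monoˡ-≤ b k≤a) (≤-reflexive eq))

row-bound : ∀ {h r c} → 2 ≤ c → r + c ≤ suc (h + 2) → r ≤ suc h
row-bound {h} {r} c≥2 rc≤ = +-cancelʳ-≤ 2 r (suc h) (≤-trans (+-monoʳ-≤ r c≥2) rc≤)

action-hit : ∀ K → action K (key K) ≡ stop
action-hit K with K ≡ᵇ K | ≡⇒≡ᵇ K K refl
... | true | _ = refl

action-above : ∀ {K n} → K < n → action K (key n) ≡ down
action-above {K} {n} K<n with n ≡ᵇ K | ≡ᵇ⇒≡ n K | K <ᵇ n | <⇒<ᵇ K<n
... | true  | n≡K | _    | _ = contradiction (n≡K tt) (>⇒≢ K<n)
... | false | _   | true | _ = refl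

action-below : ∀ {K n} → n < K → action K (key n) ≡ diag
action-below {K} {n} n<K with n ≡ᵇ K | ≡ᵇ⇒≡ n K | K <ᵇ n | <ᵇ⇒< K n
... | true  | n≡K | _     | _   = contradiction (n≡K tt) (<⇒≢ n<K)
... | false | _   | true  | K<n = contradiction (K<n tt) (<⇒≯ n<K)
... | false | _   | false | _   = refl

data Low (K : ℕ) : Entry → Set where
  low-zer : Low K zer
  low-key : ∀ {n} → n < K → Low K (key n)

low-halts-descent : ∀ {K e} → Low K e → T (leK K e)
low-halts-descent low-zer       = tt
low-halts-descent (low-key n<K) = ≤⇒≤ᵇ (<⇒≤ n<K)

low-halting-scan-is-zer : ∀ {K e} → Low K e → T (geK-or-0 K e) → e ≡ zer
low-halting-scan-is-zer low-zer             _   = refl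
low-halting-scan-is-zer (low-key {n} n<K) K≤n = contradiction (≤ᵇ⇒≤ _ n K≤n) (<⇒≱ n<K)

colDown-halts : ∀ {L K c k} → 1 ≤ k → T (leK K (L 1 c)) →
                let r = colDown L K c k in 1 ≤ r × r ≤ k × T (leK K (L r c))
colDown-halts {L} {K} {c} {suc zero} _ bottom with leK K (L 1 c) in here
... | true  = s≤s z≤n , ≤-refl , subst T (sym here) tt
... | false = ⊥-elim bottom
colDown-halts {L} {K} {c} {suc (suc k)} _ bottom
  with leK K (L (suc (suc k)) c) in here | colDown-halts {L} {K} {c} {suc k} (s≤s z≤n) bottom
... | true  | _ = s≤s z≤n , ≤-refl , subst T (sym here) tt
... | false | r≥1 , r≤k , halts = r≥1 , m≤n⇒m≤1+n r≤k , halts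

colDown-here : ∀ {L K c k} → T (leK K (L (suc k) c)) → colDown L K c (suc k) ≡ suc k
colDown-here {L} {K} {c} {k} halts with leK K (L (suc k) c)
... | true = refl

DiagHalt : Assignment → ℕ → ℕ → ℕ → ℕ × ℕ → Set
DiagHalt L K k c p =
  1 ≤ proj₁ p × proj₁ p ≤ k × proj₁ p + proj₂ p ≡ k + c ×
  T (geK-or-0 K (L (proj₁ p) (proj₂ p)))

diagScan-halts : ∀ {L K} k c → 1 ≤ k →
                 (∀ {c′} → suc c′ ≡ k + c → T (geK-or-0 K (L 1 c′))) →
                 DiagHalt L K k c (diagScan L K k c)
diagScan-halts {L} {K} (suc zero) c _ tail with geK-or-0 K (L 1 c) in here | tail {c} refl
... | true | _ = s≤s z≤n , ≤-refl , refl , subst T (sym here) tt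
diagScan-halts {L} {K} (suc (suc k)) c _ tail
  with geK-or-0 K (L (suc (suc k)) c) in here
     | diagScan-halts {L} {K} (suc k) (suc c) (s≤s z≤n) (λ e → tail (trans e (+-suc (suc k) c)))
... | true  | _ = s≤s z≤n , ≤-refl , refl , subst T (sym here) tt
... | false | r≥1 , r≤k , same , halts =
  r≥1 , m≤n⇒m≤1+n r≤k , trans same (+-suc (suc k) c) , halts

module Cost (τ : ℕ → ℕ) (L : Assignment) (K U : ℕ) (U≥1 : 1 ≤ U) where

  record Within (k r c : ℕ) : Set where
    constructor within
    field bound : ∀ f → runCost τ L K f r c ≤ k * U

  within-stop : ∀ {k r c} → action K (L r c) ≡ stop → Within (suc k) r c
  within-stop {k} {r} {c} act = within bound
    where
    bound : ∀ f → runCost τ L K f r c ≤ suc k * U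
    bound zero = z≤n
    bound (suc f) rewrite act = ≤-trans U≥1 (m≤m+n U (k * U))

  within-zer : ∀ {k r c} → L r c ≡ zer → Within (suc k) r c
  within-zer z = within-stop (cong (action K) z)

  within-down : ∀ {k r c} → action K (L r c) ≡ down → 1 + τ r ≤ U →
                Within k (colDown L K c (r ∸ 1)) c → Within (suc k) r c
  within-down {k} {r} {c} act step (within rest) = within bound
    where
    bound : ∀ f → runCost τ L K f r c ≤ suc k * U
    bound zero = z≤n
    bound (suc f) rewrite act = +-mono-≤ step (rest f)

  within-diag : ∀ {k r c} → action K (L r c) ≡ diag → 1 + τ r ≤ U →
                let p = diagScan L K (r ∸ 1) (suc c) in
                Within k (proj₁ p) (proj₂ p) → Within (suc k) r c
  within-diag {k} {r} {c} act step (within rest) = within bound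
    where
    bound : ∀ f → runCost τ L K f r c ≤ suc k * U
    bound zero = z≤n
    bound (suc f) rewrite act = +-mono-≤ step (rest f)

  within-weaken : ∀ {k k′ r c} → k ≤ k′ → Within k r c → Within k′ r c
  within-weaken k≤k′ (within w) = within (λ f → ≤-trans (w f) (*-monoˡ-≤ U k≤k′))

KeysBelow : Assignment → ℕ → ℕ → Set
KeysBelow L K d = ∀ {a b n} → 2 ≤ a → 2 ≤ b → a + b ≡ d → L a b ≡ key n → n < K

zer-not-key : ∀ {e} → e ≡ zer → ¬ IsKey e
zer-not-key refl (_ , _ , ())

key-injective : ∀ {n n′} → key n ≡ key n′ → n ≡ n′
key-injective refl = refl

module LDSFacts {h : ℕ} {L : Assignment} (lds : IsLDS h L) where
  open IsLDS lds

  row1-halts-descent : ∀ K {c} → 1 ≤ c → c ≤ h + 3 → T (leK K (L 1 c))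
  row1-halts-descent K c≥1 c≤ = subst (T ∘ leK K) (sym (row1 _ c≥1 c≤)) tt

  tail-halts-scan : ∀ K {k c} → 2 ≤ k + c → k + c ≤ h + 4 →
                    ∀ {c′} → suc c′ ≡ k + c → T (geK-or-0 K (L 1 c′))
  tail-halts-scan K kc≥2 kc≤ {c′} eq =
    subst (T ∘ geK-or-0 K) (sym (row1 c′ (≤-pred c′+1≥2) (≤-pred c′+1≤)))  tt
    where
    c′+1≥2 : 2 ≤ suc c′
    c′+1≥2 = ≤-trans kc≥2 (≤-reflexive (sym eq))
    c′+1≤ : suc c′ ≤ suc (h + 3)
    c′+1≤ = ≤-trans (≤-reflexive eq) (≤-trans kc≤ (≤-reflexive (+-suc h 3)))

  -- Column 2 holds keys from row 2 up to row h + 1 (the top one on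
  -- diagonal h + 2, whose ∞'s occupy at most the columns 3 .. h + 1).
  column2-key : ∀ {r} → 2 ≤ r → r ≤ suc h → IsKey (L r 2)
  column2-key {r} r≥2 r≤ with m≤n⇒m<n∨m≡n r≤
  ... | inj₁ (s≤s r≤h) = inner-key r 2 r≥2 ≤-refl (+-monoˡ-≤ 2 r≤h)
  ... | inj₂ refl = subst (λ x → IsKey (L x 2)) top-row (diag2-key 2 ≤-refl 2<)
    where
    top-row : h + 3 ∸ 2 ≡ suc h
    top-row = trans (+-∸-assoc h (s≤s (s≤s z≤n))) (+-comm h 1)
    m<height : m < h
    m<height = subst (_≤ h) (+-comm m 1) m<h
    2< : 2 < h + 2 ∸ m
    2< = subst (2 <_) (sym (+-∸-comm 2 (<⇒≤ m<height))) (+-monoˡ-≤ 2 (m<n⇒0<n∸m m<height))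

  diagonal-monotone : ∀ {a b a′ b′ n n′} → InDiagram h a b → InDiagram h a′ b′ →
                      a + b ≡ a′ + b′ → b ≤ b′ → L a b ≡ key n → L a′ b′ ≡ key n′ → n ≤ n′
  diagonal-monotone {a} {b} {a′} {b′} cell cell′ same b≤b′ e e′ with m≤n⇒m<n∨m≡n b≤b′
  ... | inj₁ b<b′ = <⇒≤ (incDiag a b a′ b′ cell cell′ same b<b′ _ _ e e′)
  ... | inj₂ refl with +-cancelʳ-≡ b a a′ same
  ...   | refl = ≤-reflexive (key-injective (trans (sym e) e′))

  low-on-diagonal : ∀ {K d a b} → KeysBelow L K d → d ≤ h + 2 →
                    1 ≤ a → 2 ≤ b → a + b ≡ d → Low K (L a b)
  low-on-diagonal {K} {d} {suc zero} {b} _ d≤ _ b≥2 eq =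
    subst (Low K) (sym (row1 b (≤-trans (s≤s z≤n) b≥2) b≤)) low-zer
    where
    b≤ : b ≤ h + 3
    b≤ = ≤-trans (n≤1+n b) (≤-trans (≤-reflexive eq) (≤-trans d≤ (+-monoʳ-≤ h (n≤1+n 2))))
  low-on-diagonal {K} {d} {suc (suc a)} {b} below d≤ _ b≥2 eq
    with inner-key (suc (suc a)) b (s≤s (s≤s z≤n)) b≥2 (≤-trans (≤-reflexive eq) d≤)
  ... | n , _ , e = subst (Low K) (sym e) (low-key (below (s≤s (s≤s z≤n)) b≥2 eq e))

  diagEntry-cell : ∀ s j → diagEntry L s j ≡ L (suc s ∸ j) j
  diagEntry-cell s j = cong (λ x → L (x ∸ j) j) (+-comm s 1)

-- What h-sortedness gives: the key at (r , 2), the first key of its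
-- anti-diagonal, exceeds every key of the previous anti-diagonal (whose
-- last key sits at (2 , r - 1)).

module Sorted {h : ℕ} {L : Assignment} (HS : HSorted h L) where
  open HSorted HS
  open IsLDS lds
  open LDSFacts lds

  below-column2 : ∀ {r y a b n} → 3 ≤ r → r ≤ suc h → L r 2 ≡ key y →
                  2 ≤ a → 2 ≤ b → a + b ≡ suc r → L a b ≡ key n → n < y
  below-column2 {suc (suc (suc t))} {y} {a} {b} {n} (s≤s (s≤s (s≤s z≤n))) r≤ ey a≥2 b≥2 eq e =
    ≤-<-trans n≤μ μ<y
    where
    -- the diagonals s - 1 and s of the definition of h-sortedness, s = 4 + t
    s≤ : 4 + t ≤ h + 2
    s≤ = subst (4 + t ≤_) (+-comm 2 h) (+-monoʳ-≤ 2 (≤-pred r≤))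
    s≤h+3 : 4 + t ≤ h + 3
    s≤h+3 = ≤-trans s≤ (+-monoʳ-≤ h (n≤1+n 2))
    s≤h+4 : 4 + t ≤ h + 4
    s≤h+4 = ≤-trans s≤h+3 (+-monoʳ-≤ h (n≤1+n 3))
    last-key : IsKey (L 2 (2 + t))
    last-key = inner-key 2 (2 + t) ≤-refl (s≤s (s≤s z≤n)) s≤
    μ : ℕ
    μ = proj₁ last-key
    last-entry : diagEntry L (3 + t) (2 + t) ≡ L 2 (2 + t)
    last-entry = trans (diagEntry-cell (3 + t) (2 + t)) (cong (λ x → L x (2 + t)) (m+n∸n≡m 2 t))
    first : FirstProper L (4 + t) 2
    first = s≤s z≤n , s≤s (s≤s z≤n) ,
            subst IsKey (sym (diagEntry-cell (4 + t) 2)) (column2-key (s≤s (s≤s z≤n)) r≤) ,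
            column1
      where
      column1 : ∀ i → 1 ≤ i → i < 2 → ¬ IsKey (diagEntry L (4 + t) i)
      column1 (suc zero) _ _ =
        zer-not-key (trans (diagEntry-cell (4 + t) 1) (col1 (4 + t) (s≤s z≤n) s≤h+3))
      column1 (suc (suc _)) _ (s≤s (s≤s ()))
    last : LastProper L (3 + t) (2 + t)
    last = s≤s z≤n , n≤1+n _ , subst IsKey (sym last-entry) last-key , row1-cell
      where
      row1-cell : ∀ i → 2 + t < i → i ≤ 3 + t → ¬ IsKey (diagEntry L (3 + t) i)
      row1-cell i lo hi with ≤-antisym hi lo
      ... | refl = zer-not-key (trans (diagEntry-cell (3 + t) (3 + t))
                     (trans (cong (λ x → L x (3 + t)) (m+n∸n≡m 1 t))
                            (row1 (3 + t) (s≤s z≤n) (≤-trans (n≤1+n _) s≤h+3))))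
    μ<y : μ < y
    μ<y = sorted (4 + t) (s≤s (s≤s (s≤s (s≤s z≤n)))) s≤ 2 (2 + t) first last μ y
                 (trans last-entry (proj₂ (proj₂ last-key))) (trans (diagEntry-cell (4 + t) 2) ey)
    n≤μ : n ≤ μ
    n≤μ = diagonal-monotone
            (≤-trans (s≤s z≤n) a≥2 , ≤-trans (s≤s z≤n) b≥2 , ≤-trans (≤-reflexive eq) s≤h+4)
            (s≤s z≤n , s≤s z≤n , s≤h+4)
            eq (column-before a≥2 eq) e (proj₂ (proj₂ last-key))

  keys-below-column2 : ∀ {K r y} → r ≤ suc h → L r 2 ≡ key y → y < K → KeysBelow L K (suc r)
  keys-below-column2 r≤ ey y<K a≥2 b≥2 eq e =
    <-trans (below-column2 (≤-pred (≤-trans (+-mono-≤ a≥2 b≥2) (≤-reflexive eq))) r≤ ey a≥2 b≥2 eq e) y<K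

module Search (τ : ℕ → ℕ) {h : ℕ} {L : Assignment} (HS : HSorted h L) (K U : ℕ)
              (step : ∀ {r} → 1 ≤ r → r ≤ suc h → 1 + τ r ≤ U) where
  open HSorted HS
  open IsLDS lds
  open LDSFacts lds
  open Sorted HS
  open Cost τ L K U (≤-trans (s≤s z≤n) (step {1} ≤-refl (s≤s z≤n)))

  h+2≤h+3 : h + 2 ≤ h + 3
  h+2≤h+3 = +-monoʳ-≤ h (n≤1+n 2)

  h≥1 : 1 ≤ h
  h≥1 = ≤-trans (s≤s z≤n) h≥3

  bottom-zer : ∀ {c} → 1 ≤ c → c ≤ h + 2 → L 1 c ≡ zer
  bottom-zer c≥1 c≤ = row1 _ c≥1 (≤-trans c≤ h+2≤h+3)

  -- Tail phase: on an anti-diagonal whose keys are all below K the search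
  -- stops, or makes one diagonal jump, which runs into the 0 at the tail.
  tail-phase : ∀ {r c d} → 1 ≤ r → 2 ≤ c → r + c ≡ d → d ≤ h + 2 → KeysBelow L K d → Within 2 r c
  tail-phase {suc zero} {c} _ c≥2 rc≡ d≤ _ =
    within-zer (bottom-zer (≤-trans (s≤s z≤n) c≥2) (≤-trans (n≤1+n c) (≤-trans (≤-reflexive rc≡) d≤)))
  tail-phase {suc (suc r)} {c} {d} _ c≥2 rc≡ d≤ below
    with L (suc (suc r)) c in cell | low-on-diagonal below d≤ (s≤s z≤n) c≥2 rc≡
  ... | zer   | low-zer     = within-zer cell
  ... | key n | low-key n<K =
    within-diag (trans (cong (action K) cell) (action-below n<K))
                (step (s≤s z≤n) (row-bound c≥2 (≤-trans (≤-reflexive rc≡) (≤-trans d≤ (n≤1+n _)))))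
                at-tail
    where
    same-diagonal : suc r + suc c ≡ d
    same-diagonal = trans (+-suc (suc r) c) rc≡
    at-tail : Within 1 (proj₁ (diagScan L K (suc r) (suc c))) (proj₂ (diagScan L K (suc r) (suc c)))
    at-tail with diagScan-halts {L} {K} (suc r) (suc c) (s≤s z≤n)
                   (tail-halts-scan K {suc r} {suc c} (s≤s (≤-trans (s≤s z≤n) (m≤n+m (suc c) r)))
                      (≤-trans (≤-reflexive same-diagonal) (≤-trans d≤ (+-monoʳ-≤ h (m≤n+m 2 2)))))
    ... | a≥1 , a≤ , same , halts =
      within-zer (low-halting-scan-is-zer
        (low-on-diagonal below d≤ a≥1 (≤-trans c≥2 (≤-trans (n≤1+n c) (column-after a≤ same)))
                         (trans same same-diagonal))
        halts)

  -- Descent phase: jumping down from a cell whose lower anti-diagonal has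
  -- all keys below K moves exactly one row, onto that anti-diagonal.
  descent-phase : ∀ {r c d} → 2 ≤ r → 2 ≤ c → r + c ≡ suc d → d ≤ h + 2 → KeysBelow L K d →
                  action K (L r c) ≡ down → Within 3 r c
  descent-phase {suc (suc r)} {c} {d} (s≤s (s≤s z≤n)) c≥2 rc≡ d≤ below act =
    within-down act (step (s≤s z≤n) (row-bound c≥2 (≤-trans (≤-reflexive rc≡) (s≤s d≤))))
      (subst (λ x → Within 2 x c) (sym one-row-down) (tail-phase (s≤s z≤n) c≥2 lower-diagonal d≤ below))
    where
    lower-diagonal : suc r + c ≡ d
    lower-diagonal = suc-injective rc≡
    one-row-down : colDown L K c (suc r) ≡ suc r
    one-row-down = colDown-here {L} {K} {c} {r}
      (low-halts-descent (low-on-diagonal below d≤ (s≤s z≤n) c≥2 lower-diagonal))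

  -- Landing phase: where a diagonal scan halts (0, ∞ or a key ≥ K) the
  -- search stops, or jumps down into the tail phase.
  landing-phase : ∀ {r c d} → 1 ≤ r → 2 ≤ c → r + c ≡ suc d → d ≤ h + 2 → KeysBelow L K d →
                  T (geK-or-0 K (L r c)) → Within 3 r c
  landing-phase {suc zero} {c} _ c≥2 rc≡ d≤ _ _ =
    within-zer (bottom-zer (≤-trans (s≤s z≤n) c≥2) (≤-trans (≤-reflexive (suc-injective rc≡)) d≤))
  landing-phase {suc (suc r)} {c} _ c≥2 rc≡ d≤ below halts with L (suc (suc r)) c in cell
  ... | zer = within-zer cell
  ... | ∞   = descent-phase (s≤s (s≤s z≤n)) c≥2 rc≡ d≤ below (cong (action K) cell)
  ... | key n with <-cmp n K
  ...   | tri< n<K _ _  = contradiction (≤ᵇ⇒≤ K n halts) (<⇒≱ n<K)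
  ...   | tri≈ _ refl _ = within-stop (trans (cong (action K) cell) (action-hit K))
  ...   | tri> _ _ K<n  =
    descent-phase (s≤s (s≤s z≤n)) c≥2 rc≡ d≤ below (trans (cong (action K) cell) (action-above K<n))

  -- A diagonal jump out of column 2 past a key y < K: the previous
  -- anti-diagonal lies below y (h-sortedness), so a landing phase follows.
  column2-forward : ∀ {r y} → 2 ≤ r → r ≤ suc h → L r 2 ≡ key y → y < K → Within 4 r 2
  column2-forward {suc r} {y} (s≤s r≥1) r≤ ey y<K =
    within-diag (trans (cong (action K) ey) (action-below y<K)) (step (s≤s z≤n) r≤) landed
    where
    r≤h : r ≤ h
    r≤h = ≤-pred r≤
    landed : Within 3 (proj₁ (diagScan L K r 3)) (proj₂ (diagScan L K r 3))
    landed with diagScan-halts {L} {K} r 3 r≥1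
                  (tail-halts-scan K {r} {3} (≤-trans (n≤1+n 2) (m≤n+m 3 r))
                     (≤-trans (+-monoˡ-≤ 3 r≤h) (+-monoʳ-≤ h (n≤1+n 3))))
    ... | a≥1 , a≤r , same , halts =
      landing-phase a≥1 (≤-trans (n≤1+n 2) (column-after a≤r same)) (trans same (+-comm r 3))
                    (subst (_≤ h + 2) (+-comm r 2) (+-monoˡ-≤ 2 r≤h))
                    (keys-below-column2 r≤ ey y<K) halts

  -- After descending column 2 the search stands on 0, on K, or on a key
  -- below K, from which it jumps forward.
  column2-landing : ∀ {r} → 1 ≤ r → r ≤ h → T (leK K (L r 2)) → Within 4 r 2
  column2-landing {suc zero} _ _ _ = within-zer (bottom-zer (s≤s z≤n) (m≤n+m 2 h))
  column2-landing {suc (suc r)} _ r≤h halts with column2-key (s≤s (s≤s z≤n)) (m≤n⇒m≤1+n r≤h)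
  ... | y , _ , ey with <-cmp y K
  ...   | tri< y<K _ _  = column2-forward (s≤s (s≤s z≤n)) (m≤n⇒m≤1+n r≤h) ey y<K
  ...   | tri≈ _ refl _ = within-stop (trans (cong (action K) ey) (action-hit K))
  ...   | tri> _ _ K<y  = contradiction (≤ᵇ⇒≤ y K (subst (T ∘ leK K) ey halts)) (<⇒≱ K<y)

  search-bound : Within 5 (suc h) 2
  search-bound with column2-key (s≤s h≥1) ≤-refl
  ... | x , _ , ex with <-cmp x K
  ...   | tri< x<K _ _  = within-weaken (n≤1+n 4) (column2-forward (s≤s h≥1) ≤-refl ex x<K)
  ...   | tri≈ _ refl _ = within-stop (trans (cong (action K) ex) (action-hit K))
  ...   | tri> _ _ K<x  =
    within-down (trans (cong (action K) ex) (action-above K<x)) (step (s≤s z≤n) ≤-refl) descended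
    where
    descended : Within 4 (colDown L K 2 h) 2
    descended with colDown-halts {L} {K} {2} {h} h≥1 (row1-halts-descent K (s≤s z≤n) (≤-trans (n≤1+n 2) (m≤n+m 3 h)))
    ... | r≥1 , r≤h , halts = column2-landing r≥1 r≤h halts

rowCount-mono : ∀ L r {m n} → m ≤ n → rowCount L r m ≤ rowCount L r n
rowCount-mono L r {n = zero} z≤n = ≤-refl
rowCount-mono L r {m} {suc n} m≤ with m≤n⇒m<n∨m≡n m≤
... | inj₂ refl       = ≤-refl
... | inj₁ (s≤s m≤n) = ≤-trans (rowCount-mono L r m≤n) (m≤n+m _ (isKeyᵇ (L r (suc n))))

row-in-rows : ∀ h L {r k} → 1 ≤ r → r ≤ k → rowCount L r (h + 4 ∸ r) ≤ rowsCount h L k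
row-in-rows h L {k = zero} (s≤s _) ()
row-in-rows h L {r} {suc k} r≥1 r≤ with m≤n⇒m<n∨m≡n r≤
... | inj₂ refl       = m≤m+n _ _
... | inj₁ (s≤s r≤k) = ≤-trans (row-in-rows h L r≥1 r≤k) (m≤n+m _ _)

-- Columns 2 .. n of row 2 hold keys, for n ≤ h.
row2-count : ∀ {h L} → IsLDS h L → ∀ n → n ≤ h → n ≤ suc (rowCount L 2 n)
row2-count lds zero          _   = z≤n
row2-count lds (suc zero)    _   = s≤s z≤n
row2-count {h} {L} lds (suc (suc n)) n≤h =
  subst (λ e → suc (suc n) ≤ suc (isKeyᵇ e + rowCount L 2 (suc n))) (sym is-key)
        (s≤s (row2-count lds (suc n) (≤-trans (n≤1+n _) n≤h)))
  where
  is-key : L 2 (suc (suc n)) ≡ key _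
  is-key = proj₂ (proj₂ (IsLDS.inner-key lds 2 (suc (suc n)) ≤-refl (s≤s (s≤s z≤n))
                           (subst (_≤ h + 2) (+-comm (suc (suc n)) 2) (+-monoˡ-≤ 2 n≤h))))

numKeys-lower : ∀ {h L} → IsLDS h L → h ≤ suc (numKeys h L)
numKeys-lower {h} {L} lds = begin
  h                                    ≤⟨ row2-count lds h ≤-refl ⟩
  suc (rowCount L 2 h)                 ≤⟨ s≤s (rowCount-mono L 2 h≤row2-length) ⟩
  suc (rowCount L 2 (h + 4 ∸ 2))       ≤⟨ s≤s (row-in-rows h L (s≤s z≤n) (≤-trans (n≤1+n 2) (m≤n+m 3 h))) ⟩
  suc (numKeys h L)                    ∎
  where
  open ≤-Reasoning
  h≤row2-length : h ≤ h + 4 ∸ 2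
  h≤row2-length = ≤-trans (m≤m+n h 2) (≤-reflexive (sym (+-∸-assoc h (s≤s (s≤s z≤n)))))

log-height : ∀ {h N} → 3 ≤ h → h ≤ suc N → ⌊log₂ (suc h) ⌋ ≤ suc ⌊log₂ N ⌋
log-height {h} {zero} h≥3 h≤1 = contradiction (≤-trans h≥3 h≤1) λ { (s≤s ()) }
log-height {h} {suc N} h≥3 h≤ = begin
  ⌊log₂ (suc h) ⌋          ≤⟨ ⌊log₂⌋-mono-≤ h+1≤2N ⟩
  ⌊log₂ (2 * suc N) ⌋      ≡⟨ ⌊log₂[2*b]⌋≡1+⌊log₂b⌋ (suc N) ⟩
  suc ⌊log₂ (suc N) ⌋      ∎
  where
  open ≤-Reasoning
  N≥1 : 1 ≤ N
  N≥1 = ≤-pred (≤-pred (≤-trans h≥3 h≤))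
  double : ∀ N → 2 * suc N ≡ 2 + (N + N)
  double = solve-∀
  h+1≤2N : suc h ≤ 2 * suc N
  h+1≤2N = ≤-trans (s≤s h≤) (≤-trans (+-monoʳ-≤ 2 (+-monoˡ-≤ N N≥1)) (≤-reflexive (sym (double N))))

iteration-bound : ∀ c ℓ λ′ → λ′ ≤ suc ℓ → 1 + c * (λ′ + 1) ≤ (1 + 2 * c) * (ℓ + 1)
iteration-bound c ℓ λ′ λ′≤ = begin
  1 + c * (λ′ + 1)                   ≤⟨ +-monoʳ-≤ 1 (*-monoʳ-≤ c (+-monoˡ-≤ 1 λ′≤)) ⟩
  1 + c * (suc ℓ + 1)                ≤⟨ m≤m+n _ (ℓ + c * ℓ) ⟩
  1 + c * (suc ℓ + 1) + (ℓ + c * ℓ)  ≡⟨ expand c ℓ ⟩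
  (1 + 2 * c) * (ℓ + 1)              ∎
  where
  open ≤-Reasoning
  expand : ∀ c ℓ → 1 + c * (suc ℓ + 1) + (ℓ + c * ℓ) ≡ (1 + 2 * c) * (ℓ + 1)
  expand = solve-∀

corollary6 : (T : ℕ → ℕ) →
    (∃[ c ] (∀ m → 1 ≤ m → T m ≤ c * (⌊log₂ m ⌋ + 1))) →
    ∃[ C ] (∀ h (L : Assignment) → HSorted h L → ∀ K → 0 < K →
      jumpSearchCost T h L K ≤ C * (⌊log₂ numKeys h L ⌋ + 1))
corollary6 T (c , T≤) = 5 * (1 + 2 * c) , λ h L HS K _ →
  let open ≤-Reasoning
      N = numKeys h L
      U = 1 + c * (⌊log₂ (suc h) ⌋ + 1)
      step : ∀ {r} → 1 ≤ r → r ≤ suc h → 1 + T r ≤ U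
      step {r} r≥1 r≤ = s≤s (≤-trans (T≤ r r≥1) (*-monoʳ-≤ c (+-monoˡ-≤ 1 (⌊log₂⌋-mono-≤ r≤))))
      log-h = log-height (HSorted.h≥3 HS) (numKeys-lower (HSorted.lds HS))
  in begin
    jumpSearchCost T h L K             ≡⟨ cong (λ r → runCost T L K (h + 2) r 2) (+-comm h 1) ⟩
    runCost T L K (h + 2) (suc h) 2    ≤⟨ Cost.Within.bound (Search.search-bound T HS K U step) (h + 2) ⟩
    5 * U                              ≤⟨ *-monoʳ-≤ 5 (iteration-bound c ⌊log₂ N ⌋ _ log-h) ⟩
    5 * ((1 + 2 * c) * (⌊log₂ N ⌋ + 1)) ≡⟨ sym (*-assoc 5 (1 + 2 * c) _) ⟩
    5 * (1 + 2 * c) * (⌊log₂ N ⌋ + 1)   ∎
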